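{- For every $n\ge 2$, the number $c(n)$ of convex polyominoes of semi-perimeter $n$ satisfies \[c(n)=2a(n)+k(n)-\ell(n),\] where $a(n)$ is the number of ascending polyominoes of semi-perimeter $n$, $k(n)$ is the number of convex polyominoes of semi-perimeter $n$ with NE-degree and NW-degree of convexity both equal to $2$, and $\ell(n)$ is the number of $L$-convex polyominoes of semi-perimeter $n$.
   Context: A polyomino is a finite edge-connected set of unit cells of the square lattice; it is convex if every row and every column is a contiguous segment of cells. The size (semi-perimeter) of a convex polyomino is half its perimeter, i.e. the width plus the height of its minimal bounding rectangle. A NE-path (resp. NW-path) inside $P$ is a sequence of cells of $P$, consecutive cells sharing an edge, every step going North or East (resp. North or West). Write $a\nearrow b$ (resp. $a\nwarrow b$) if such a path exists from $a$ to $b$. For $a\nearrow b$, $D_{NE}(a,b)$ is the minimum number of changes of direction among NE-paths inside $P$ from $a$ to $b$, and $D_{NE}(P)=\max\{D_{NE}(a,b):a\nearrow b\}$; $D_{NW}(a,b)$, $D_{NW}(P)$ are analogous with NW-paths. A convex polyomino is $L$-convex if any two of its cells are joined by a monotone path inside $P$ (all steps in two fixed directions among N/S and E/W) with at most one change of direction, equivalently $D_{NE}(P)\le1$ and $D_{NW}(P)\le1$. A convex polyomino $P$ is ascending if $D_{NW}(P)\le 1$. -}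

module Defs where

open import Data.Nat using (ℕ; zero; suc; _+_; _*_; _∸_; _≤_)
open import Data.Bool using (Bool; true; false; if_then_else_)
open import Data.Maybe using (Maybe; just; nothing)
open import Data.List using (List; []; _∷_; [_]; map; concatMap; upTo)
open import Data.Vec using (Vec; []; _∷_)
open import Data.Product using (Σ; ∃; _×_; _,_)
open import Data.Sum using (_⊎_)
open import Data.Unit using (⊤)
open import Data.Empty using (⊥)
open import Relation.Nullary using (¬_)
open import Relation.Binary.PropositionalEquality using (_≡_)

-- Cells of the square lattice (column x, row y); North = y+1, East = x+1.

Cell : Set
Cell = ℕ × ℕ

data Dir : Set where
  N S E W : Dir

data Move : Cell → Dir → Cell → Set where
  mvN : ∀ {x y} → Move (x , y) N (x , suc y)
  mvS : ∀ {x y} → Move (x , suc y) S (x , y)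
  mvE : ∀ {x y} → Move (x , y) E (suc x , y)
  mvW : ∀ {x y} → Move (suc x , y) W (x , y)

-- A finite set of cells inside the w × h rectangle [0,w) × [0,h),
-- stored column by column.

Grid : ℕ → ℕ → Set
Grid w h = Vec (Vec Bool h) w

vget : ∀ {A : Set} {n} → Vec A n → ℕ → Maybe A
vget []       _       = nothing
vget (x ∷ xs) zero    = just x
vget (x ∷ xs) (suc i) = vget xs i

memCol : ∀ {h} → Maybe (Vec Bool h) → ℕ → Bool
memCol nothing    y = false
memCol (just col) y with vget col y
... | just b  = b
... | nothing = false

mem : ∀ {w h} → Grid w h → ℕ → ℕ → Bool
mem G x y = memCol (vget G x) y

_∈G_ : ∀ {w h} → Cell → Grid w h → Set
(x , y) ∈G G = mem G x y ≡ true

data Path {w h} (G : Grid w h) (ok : Dir → Set) : Cell → Cell → List Dir → Set where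
  stop : ∀ {a} → a ∈G G → Path G ok a a []
  step : ∀ {a b c d ds} → a ∈G G → Move a d b → ok d →
         Path G ok b c ds → Path G ok a c (d ∷ ds)

AnyDir : Dir → Set
AnyDir _ = ⊤

NEDir : Dir → Set
NEDir N = ⊤
NEDir E = ⊤
NEDir _ = ⊥

NWDir : Dir → Set
NWDir N = ⊤
NWDir W = ⊤
NWDir _ = ⊥

sameDir : Dir → Dir → Bool
sameDir N N = true
sameDir S S = true
sameDir E E = true
sameDir W W = true
sameDir _ _ = false

turns : List Dir → ℕ
turns []           = 0
turns (d ∷ [])     = 0
turns (d ∷ e ∷ ds) = (if sameDir d e then 0 else 1) + turns (e ∷ ds)

-- Convex polyomino whose minimal bounding rectangle is exactly w × h
-- (placed with lower-left corner at the origin: every column x < w and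
-- every row y < h contains a cell).  This normalises polyominoes up to
-- translation, so the semi-perimeter is w + h.

IsConvexPolyomino : ∀ {w h} → Grid w h → Set
IsConvexPolyomino {w} {h} G =
  (∃ λ (a : Cell) → a ∈G G)
  × (∀ a b → a ∈G G → b ∈G G → ∃ λ ds → Path G AnyDir a b ds)
  × (∀ x y₁ y₂ y → (x , y₁) ∈G G → (x , y₂) ∈G G → y₁ ≤ y → y ≤ y₂ → (x , y) ∈G G)
  × (∀ y x₁ x₂ x → (x₁ , y) ∈G G → (x₂ , y) ∈G G → x₁ ≤ x → x ≤ x₂ → (x , y) ∈G G)
  × (∀ x → suc x ≤ w → ∃ λ y → (x , y) ∈G G)
  × (∀ y → suc y ≤ h → ∃ λ x → (x , y) ∈G G)

-- D_ok(G) ≤ d : whenever a path of the given kind goes from a to b,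
-- some such path has at most d changes of direction.
DegLE : ∀ {w h} → (Dir → Set) → Grid w h → ℕ → Set
DegLE ok G d = ∀ a b → (∃ λ ds → Path G ok a b ds) →
               ∃ λ ds → Path G ok a b ds × turns ds ≤ d

DegEq2 : ∀ {w h} → (Dir → Set) → Grid w h → Set
DegEq2 ok G = DegLE ok G 2 × ¬ DegLE ok G 1

-- monotone: all steps in {v, hz} with v ∈ {N,S}, hz ∈ {E,W}
IsLConvex : ∀ {w h} → Grid w h → Set
IsLConvex G =
  IsConvexPolyomino G ×
  (∀ a b → a ∈G G → b ∈G G →
     ∃ λ v → ∃ λ hz → (v ≡ N ⊎ v ≡ S) × (hz ≡ E ⊎ hz ≡ W) ×
       ∃ λ ds → Path G (λ d → d ≡ v ⊎ d ≡ hz) a b ds × turns ds ≤ 1)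

IsAscending : ∀ {w h} → Grid w h → Set
IsAscending G = IsConvexPolyomino G × DegLE NWDir G 1

IsDeg22 : ∀ {w h} → Grid w h → Set
IsDeg22 G = IsConvexPolyomino G × DegEq2 NEDir G × DegEq2 NWDir G

-- Enumeration of all candidate shapes of semi-perimeter n:
-- pairs (w , G) with G a w × (n ∸ w) grid, w = 0 … n.

allVecs : ∀ {A : Set} (k : ℕ) → List A → List (Vec A k)
allVecs zero    xs = [ [] ]
allVecs (suc k) xs = concatMap (λ x → map (x ∷_) (allVecs k xs)) xs

allGrids : (w h : ℕ) → List (Grid w h)
allGrids w h = allVecs w (allVecs h (true ∷ false ∷ []))

Shape : ℕ → Set
Shape n = Σ ℕ λ w → Grid w (n ∸ w)

shapes : (n : ℕ) → List (Shape n)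
shapes n = concatMap (λ w → map (w ,_) (allGrids w (n ∸ w))) (upTo (suc n))

onShape : ∀ {n} → (∀ {w h} → Grid w h → Set) → Shape n → Set
onShape Q (w , G) = Q G

data Count {A : Set} (P : A → Set) : List A → ℕ → Set where
  nil  : Count P [] 0
  here : ∀ {x xs k} → P x → Count P xs k → Count P (x ∷ xs) (suc k)
  skip : ∀ {x xs k} → ¬ P x → Count P xs k → Count P (x ∷ xs) k

-- For a convex polyomino P, D_NE(P) ≤ 1 holds exactly when for all cells a ↗ b one of the
-- other two corners of the rectangle spanned by a and b lies in P: a path with one turn
-- passes through such a corner, and two straight segments through it make such a path.
-- The same holds for D_NW, and P is L-convex iff both corner conditions hold.  These
-- conditions quantify over pairs of cells only, so all the classes are decidable.
--
-- The geometric core: if a ↗ b and p ↖ q are both pairs without corners, then a and b are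
-- joined by a NE path with two turns.  The missing corners leave four quadrants of the plane
-- without cells.  Either the NW path from p to q crosses both columns of a and b (or both of
-- their rows), which provides the middle segment of such a path, or one of a, b, p, q would
-- lie in an empty quadrant.  So D_NE, D_NW > 1 forces D_NE = 2, and D_NW = 2 by reflection.
-- Sorting convex polyominoes by the two corner conditions gives c + l = a + d + k, with d the
-- number of descending ones (D_NE ≤ 1); reversing the order of the columns exchanges
-- ascending and descending grids and permutes the enumeration, so d = a.  None of this uses
-- n ≥ 2: for smaller n no grid has a cell and all counts vanish.

module Submission where

open import Defs
open import Data.Nat using (ℕ; zero; suc; _+_; _*_; _∸_; _≤_; _<_; z≤n; s≤s; _≟_; _≤?_; _<?_; _≤′_; ≤′-refl; ≤′-step)
open import Data.Nat.Properties
open import Algebra.Properties.CommutativeSemigroup +-commutativeSemigroup using (interchange)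
open import Data.Bool using (Bool; true; false; if_then_else_; _∧_; not)
import Data.Bool.Properties as Bool
open import Data.Maybe using (Maybe; just; nothing)
open import Data.List using (List; []; _∷_; map; concatMap; upTo; _++_; replicate)
open import Data.List.Properties using (map-cong; map-++; map-∘)
open import Data.Nat.ListAction using (sum)
open import Data.Nat.ListAction.Properties using (sum-++)
open import Data.Vec using (Vec; []; _∷_; _∷ʳ_; reverse)
open import Data.Vec.Properties using (reverse-∷)
open import Data.Product using (∃; _×_; _,_; proj₁; proj₂)
open import Data.Sum using (_⊎_; inj₁; inj₂)
open import Data.Unit using (tt)
open import Data.Empty using (⊥-elim)
open import Function using (_∘_)
open import Relation.Nullary using (¬_; Dec; yes; no; does)
open import Relation.Nullary.Decidable using (_×-dec_; _⊎-dec_; _→-dec_; ¬?; map′; decidable-stable; does-⇔)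
import Relation.Nullary.Decidable as Dec
open import Function.Bundles using (_⇔_; mk⇔)
open import Relation.Binary.PropositionalEquality using (_≡_; refl; sym; trans; cong; cong₂; subst; module ≡-Reasoning)
open ≡-Reasoning

vget-just⇒< : ∀ {A : Set} {n} (v : Vec A n) i {a} → vget v i ≡ just a → i < n
vget-just⇒< (_ ∷ _) zero    _  = s≤s z≤n
vget-just⇒< (_ ∷ v) (suc i) eq = s≤s (vget-just⇒< v i eq)

memCol-true⇒< : ∀ {h} (c : Maybe (Vec Bool h)) y → memCol c y ≡ true → y < h
memCol-true⇒< nothing y ()
memCol-true⇒< (just col) y m with vget col y in eq
memCol-true⇒< (just col) y m  | just _  = vget-just⇒< col y eq
memCol-true⇒< (just col) y () | nothing

mem-true⇒< : ∀ {w h} (G : Grid w h) x y → mem G x y ≡ true → x < w × y < h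
mem-true⇒< G x y m with vget G x in eq
mem-true⇒< G x y m  | just col = vget-just⇒< G x eq , memCol-true⇒< (just col) y m
mem-true⇒< G x y () | nothing

_≤ne_ _≤nw_ : Cell → Cell → Set
(ax , ay) ≤ne (bx , by) = ax ≤ bx × ay ≤ by
(ax , ay) ≤nw (bx , by) = bx ≤ ax × ay ≤ by

_∈G?_ : ∀ {w h} c (G : Grid w h) → Dec (c ∈G G)
(x , y) ∈G? G = mem G x y Bool.≟ true

module _ {w h} (G : Grid w h) where

  ∈G-bounded : ∀ {x y} → (x , y) ∈G G → x < w × y < h
  ∈G-bounded = mem-true⇒< G _ _

_≤ne?_ : ∀ a b → Dec (a ≤ne b)
(ax , ay) ≤ne? (bx , by) = (ax ≤? bx) ×-dec (ay ≤? by)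

_≤nw?_ : ∀ a b → Dec (a ≤nw b)
(ax , ay) ≤nw? (bx , by) = (bx ≤? ax) ×-dec (ay ≤? by)

-- One of the other two corners of the rectangle spanned by a and b lies in G: the turning
-- point of an L-shaped path from a to b that moves horizontally, resp. vertically, first.
data HasCorner {w h} (G : Grid w h) : Cell → Cell → Set where
  horizontal-first : ∀ {ax ay bx by} → (bx , ay) ∈G G → HasCorner G (ax , ay) (bx , by)
  vertical-first   : ∀ {ax ay bx by} → (ax , by) ∈G G → HasCorner G (ax , ay) (bx , by)

HasCorner? : ∀ {w h} (G : Grid w h) a b → Dec (HasCorner G a b)
HasCorner? G (ax , ay) (bx , by) =
  map′ (λ { (inj₁ m) → horizontal-first m ; (inj₂ m) → vertical-first m })
       (λ { (horizontal-first m) → inj₁ m ; (vertical-first m) → inj₂ m })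
       (((bx , ay) ∈G? G) ⊎-dec ((ax , by) ∈G? G))

HasCorner-sym : ∀ {w h} {G : Grid w h} {a b} → HasCorner G a b → HasCorner G b a
HasCorner-sym (horizontal-first m) = vertical-first m
HasCorner-sym (vertical-first m)   = horizontal-first m

IsInterval : (ℕ → Set) → Set
IsInterval A = ∀ {m k n} → A m → A n → m ≤ k → k ≤ n → A k

data Side : Set where
  below above : Side

HalfLine : Side → ℕ → ℕ → Set
HalfLine below e x = x ≤ e
HalfLine above e x = e ≤ x

HalfLine? : ∀ s e x → Dec (HalfLine s e x)
HalfLine? below e x = x ≤? e
HalfLine? above e x = e ≤? x

interval-crossing : ∀ {A s e m n} → IsInterval A → A m → A n → HalfLine s e m → ¬ HalfLine s e n → A e
interval-crossing {s = below} I am an m≤e n≰e = I am an m≤e (<⇒≤ (≰⇒> n≰e))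
interval-crossing {s = above} I am an e≤m e≰n = I an am (<⇒≤ (≰⇒> e≰n)) e≤m

leave-upward : ∀ {s e y} → HalfLine s e y → ¬ HalfLine s e (suc y) → y ≡ e
leave-upward {below} y≤e sy≰e = ≤-antisym y≤e (≮⇒≥ sy≰e)
leave-upward {above} e≤y e≰sy = ⊥-elim (e≰sy (m≤n⇒m≤1+n e≤y))

leave-downward : ∀ {s e y} → HalfLine s e (suc y) → ¬ HalfLine s e y → suc y ≡ e
leave-downward {below} sy≤e y≰e = ⊥-elim (y≰e (≤-trans (n≤1+n _) sy≤e))
leave-downward {above} e≤sy e≰y = ≤-antisym (≰⇒> e≰y) e≤sy

gap : ∀ {m n} → m ≤ n → ∃ λ k → n ≡ k + m
gap m≤n = _ , sym (m∸n+n≡m m≤n)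

common-point : ∀ {A B : ℕ → Set} → IsInterval A → IsInterval B →
               ∀ {a b s s′} → A a → A s → B s′ → B b → a ≤ b → s′ ≤ s →
               ∃ λ y → a ≤ y × y ≤ b × A y × B y
common-point IA IB {a} {b} {s} {s′} Aa As Bs′ Bb a≤b s′≤s with s′ ≤? a | s′ ≤? b
... | yes s′≤a | _        = a , ≤-refl , a≤b , Aa , IB Bs′ Bb s′≤a a≤b
... | no s′≰a  | yes s′≤b = s′ , <⇒≤ (≰⇒> s′≰a) , s′≤b , IA Aa As (<⇒≤ (≰⇒> s′≰a)) s′≤s , Bs′
... | no _     | no s′≰b  = b , a≤b , ≤-refl , IA Aa As a≤b (≤-trans (<⇒≤ (≰⇒> s′≰b)) s′≤s) , Bb

module _ {w h} (G : Grid w h) where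

  Column Row : ℕ → ℕ → Set
  Column x y = (x , y) ∈G G
  Row y x = (x , y) ∈G G

  -- The components of IsConvexPolyomino, and Overlapping, which replaces Connected when
  -- convexity is decided.
  Nonempty Connected ColumnConvex RowConvex ColumnsOccupied RowsOccupied Overlapping : Set
  Nonempty = ∃ λ (a : Cell) → a ∈G G
  Connected = ∀ a b → a ∈G G → b ∈G G → ∃ λ ds → Path G AnyDir a b ds
  ColumnConvex = ∀ x y₁ y₂ y → (x , y₁) ∈G G → (x , y₂) ∈G G → y₁ ≤ y → y ≤ y₂ → (x , y) ∈G G
  RowConvex = ∀ y x₁ x₂ x → (x₁ , y) ∈G G → (x₂ , y) ∈G G → x₁ ≤ x → x ≤ x₂ → (x , y) ∈G G
  ColumnsOccupied = ∀ x → suc x ≤ w → ∃ λ y → (x , y) ∈G G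
  RowsOccupied = ∀ y → suc y ≤ h → ∃ λ x → (x , y) ∈G G
  Overlapping = ∀ x → suc x < w → ∃ λ y → (x , y) ∈G G × (suc x , y) ∈G G

module _ {w h} (G : Grid w h) where

  Path≤ : (Dir → Set) → ℕ → Cell → Cell → Set
  Path≤ ok t a b = ∃ λ ds → Path G ok a b ds × turns ds ≤ t

  Straight : (Dir → Set) → Dir → Cell → Cell → Set
  Straight ok d a b = ∃ λ k → Path G ok a b (replicate k d)

module _ {w h} {G : Grid w h} {ok : Dir → Set} where

  path-start : ∀ {a b ds} → Path G ok a b ds → a ∈G G
  path-start (stop m)       = m
  path-start (step m _ _ _) = m

  path-end : ∀ {a b ds} → Path G ok a b ds → b ∈G G
  path-end (stop m)       = m
  path-end (step _ _ _ p) = path-end p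

  infixr 5 _++ᴾ_
  _++ᴾ_ : ∀ {a b c ds es} → Path G ok a b ds → Path G ok b c es → Path G ok a c (ds ++ es)
  stop _         ++ᴾ q = q
  step m mv o p  ++ᴾ q = step m mv o (p ++ᴾ q)

  forward-run : ∀ {d} (pos : ℕ → Cell) → (∀ i → Move (pos i) d (pos (suc i))) → ok d →
                ∀ k → (∀ {i} → i ≤ k → pos i ∈G G) → Path G ok (pos 0) (pos k) (replicate k d)
  forward-run pos mv o zero    inG = stop (inG z≤n)
  forward-run pos mv o (suc k) inG =
    step (inG z≤n) (mv 0) o (forward-run (pos ∘ suc) (mv ∘ suc) o k (inG ∘ s≤s))

  backward-run : ∀ {d} (pos : ℕ → Cell) → (∀ i → Move (pos (suc i)) d (pos i)) → ok d →
                 ∀ k → (∀ {i} → i ≤ k → pos i ∈G G) → Path G ok (pos k) (pos 0) (replicate k d)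
  backward-run pos mv o zero    inG = stop (inG z≤n)
  backward-run pos mv o (suc k) inG =
    step (inG ≤-refl) (mv k) o (backward-run pos mv o k (inG ∘ m≤n⇒m≤1+n))

  module _ {x} (I : IsInterval (Column G x)) where

    north-segment : ∀ {y₁ y₂} → ok N → (x , y₁) ∈G G → (x , y₂) ∈G G → y₁ ≤ y₂ →
                    Straight G ok N (x , y₁) (x , y₂)
    north-segment {y₁} o m₁ m₂ le with gap le
    ... | k , refl = k , forward-run (λ i → x , i + y₁) (λ _ → mvN) o k
                           (λ i≤k → I m₁ m₂ (m≤n+m y₁ _) (+-monoˡ-≤ y₁ i≤k))

    south-segment : ∀ {y₁ y₂} → ok S → (x , y₁) ∈G G → (x , y₂) ∈G G → y₂ ≤ y₁ →
                    Straight G ok S (x , y₁) (x , y₂)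
    south-segment {y₂ = y₂} o m₁ m₂ le with gap le
    ... | k , refl = k , backward-run (λ i → x , i + y₂) (λ _ → mvS) o k
                           (λ i≤k → I m₂ m₁ (m≤n+m y₂ _) (+-monoˡ-≤ y₂ i≤k))

  module _ {y} (I : IsInterval (Row G y)) where

    east-segment : ∀ {x₁ x₂} → ok E → (x₁ , y) ∈G G → (x₂ , y) ∈G G → x₁ ≤ x₂ →
                   Straight G ok E (x₁ , y) (x₂ , y)
    east-segment {x₁} o m₁ m₂ le with gap le
    ... | k , refl = k , forward-run (λ i → i + x₁ , y) (λ _ → mvE) o k
                           (λ i≤k → I m₁ m₂ (m≤n+m x₁ _) (+-monoˡ-≤ x₁ i≤k))

    west-segment : ∀ {x₁ x₂} → ok W → (x₁ , y) ∈G G → (x₂ , y) ∈G G → x₂ ≤ x₁ →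
                   Straight G ok W (x₁ , y) (x₂ , y)
    west-segment {x₂ = x₂} o m₁ m₂ le with gap le
    ... | k , refl = k , backward-run (λ i → i + x₂ , y) (λ _ → mvW) o k
                           (λ i≤k → I m₂ m₁ (m≤n+m x₂ _) (+-monoˡ-≤ x₂ i≤k))

data Vertical (y₁ y₂ : ℕ) : Dir → Set where
  north : y₁ ≤ y₂ → Vertical y₁ y₂ N
  south : y₂ ≤ y₁ → Vertical y₁ y₂ S

data Horizontal (x₁ x₂ : ℕ) : Dir → Set where
  east : x₁ ≤ x₂ → Horizontal x₁ x₂ E
  west : x₂ ≤ x₁ → Horizontal x₁ x₂ W

vertical : ∀ y₁ y₂ → ∃ (Vertical y₁ y₂)
vertical y₁ y₂ with ≤-total y₁ y₂
... | inj₁ le = N , north le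
... | inj₂ ge = S , south ge

horizontal : ∀ x₁ x₂ → ∃ (Horizontal x₁ x₂)
horizontal x₁ x₂ with ≤-total x₁ x₂
... | inj₁ le = E , east le
... | inj₂ ge = W , west ge

module _ {w h} {G : Grid w h} {ok : Dir → Set} where

  column-segment : ∀ {x y₁ y₂ v} → IsInterval (Column G x) → Vertical y₁ y₂ v → ok v →
                   (x , y₁) ∈G G → (x , y₂) ∈G G → Straight G ok v (x , y₁) (x , y₂)
  column-segment I (north le) o m₁ m₂ = north-segment I o m₁ m₂ le
  column-segment I (south ge) o m₁ m₂ = south-segment I o m₁ m₂ ge

  row-segment : ∀ {y x₁ x₂ hz} → IsInterval (Row G y) → Horizontal x₁ x₂ hz → ok hz →
                (x₁ , y) ∈G G → (x₂ , y) ∈G G → Straight G ok hz (x₁ , y) (x₂ , y)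
  row-segment I (east le) o m₁ m₂ = east-segment I o m₁ m₂ le
  row-segment I (west ge) o m₁ m₂ = west-segment I o m₁ m₂ ge

sameDir-refl : ∀ d → sameDir d d ≡ true
sameDir-refl N = refl
sameDir-refl S = refl
sameDir-refl E = refl
sameDir-refl W = refl

turns-repeat : ∀ d ds → turns (d ∷ d ∷ ds) ≡ turns (d ∷ ds)
turns-repeat d ds rewrite sameDir-refl d = refl

turns-replicate-++ : ∀ k d ds → turns (replicate k d ++ ds) ≤ suc (turns ds)
turns-replicate-++ zero          d ds = n≤1+n _
turns-replicate-++ (suc zero)    d [] = z≤n
turns-replicate-++ (suc zero)    d (e ∷ ds) with sameDir d e
... | true  = n≤1+n _
... | false = ≤-refl
turns-replicate-++ (suc (suc k)) d ds =
  ≤-trans (≤-reflexive (turns-repeat d (replicate k d ++ ds))) (turns-replicate-++ (suc k) d ds)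

turns-replicate : ∀ k d → turns (replicate k d) ≡ 0
turns-replicate zero          d = refl
turns-replicate (suc zero)    d = refl
turns-replicate (suc (suc k)) d = trans (turns-repeat d (replicate k d)) (turns-replicate (suc k) d)

module _ {w h} {G : Grid w h} {ok : Dir → Set} where

  two-segments : ∀ {a b c d e} → Straight G ok d a b → Straight G ok e b c → Path≤ G ok 1 a c
  two-segments {d = d} {e} (i , p) (j , q) =
    _ , p ++ᴾ q , ≤-trans (turns-replicate-++ i d _) (s≤s (≤-reflexive (turns-replicate j e)))

  three-segments : ∀ {a b c z d e f} → Straight G ok d a b → Straight G ok e b c → Straight G ok f c z →
                   Path≤ G ok 2 a z
  three-segments {d = d} (i , p) q r with two-segments q r
  ... | ds , qr , t = _ , p ++ᴾ qr , ≤-trans (turns-replicate-++ i d ds) (s≤s t)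

module _ {w h} {G : Grid w h} where

  ne-monotone : ∀ {a b ds} → Path G NEDir a b ds → a ≤ne b
  ne-monotone (stop _)         = ≤-refl , ≤-refl
  ne-monotone (step _ mvN _ p) = let x≤ , y≤ = ne-monotone p in x≤ , <⇒≤ y≤
  ne-monotone (step _ mvE _ p) = let x≤ , y≤ = ne-monotone p in <⇒≤ x≤ , y≤

  nw-monotone : ∀ {a b ds} → Path G NWDir a b ds → a ≤nw b
  nw-monotone (stop _)         = ≤-refl , ≤-refl
  nw-monotone (step _ mvN _ p) = let x≥ , y≤ = nw-monotone p in x≥ , <⇒≤ y≤
  nw-monotone (step _ mvW _ p) = let x≥ , y≤ = nw-monotone p in m≤n⇒m≤1+n x≥ , y≤

opposite : Dir → Dir
opposite N = S
opposite S = N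
opposite E = W
opposite W = E

move-opposite : ∀ {a d b} → Move a d b → Move b (opposite d) a
move-opposite mvN = mvS
move-opposite mvS = mvN
move-opposite mvE = mvW
move-opposite mvW = mvE

path-reverse : ∀ {w h} {G : Grid w h} {a b ds} → Path G AnyDir a b ds → ∃ λ es → Path G AnyDir b a es
path-reverse (stop m) = [] , stop m
path-reverse (step m mv _ p) with path-reverse p
... | es , q = _ , q ++ᴾ step (path-start p) (move-opposite mv) tt (stop m)

data Axis : Set where
  northSouth eastWest : Axis

axis : Dir → Axis
axis N = northSouth
axis S = northSouth
axis E = eastWest
axis W = eastWest

fixed : Axis → Cell → ℕ
fixed northSouth = proj₁
fixed eastWest   = proj₂

move-fixed : ∀ {a d b} → Move a d b → fixed (axis d) a ≡ fixed (axis d) b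
move-fixed mvN = refl
move-fixed mvS = refl
move-fixed mvE = refl
move-fixed mvW = refl

sameDir⇒≡ : ∀ d e → sameDir d e ≡ true → d ≡ e
sameDir⇒≡ N N _ = refl
sameDir⇒≡ S S _ = refl
sameDir⇒≡ E E _ = refl
sameDir⇒≡ W W _ = refl
sameDir⇒≡ N S ()
sameDir⇒≡ N E ()
sameDir⇒≡ N W ()
sameDir⇒≡ S N ()
sameDir⇒≡ S E ()
sameDir⇒≡ S W ()
sameDir⇒≡ E N ()
sameDir⇒≡ E S ()
sameDir⇒≡ E W ()
sameDir⇒≡ W N ()
sameDir⇒≡ W S ()
sameDir⇒≡ W E ()

module _ {w h} {G : Grid w h} {ok : Dir → Set} where

  straight-fixed : ∀ {a b d ds} → Path G ok a b (d ∷ ds) → turns (d ∷ ds) ≡ 0 →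
                   fixed (axis d) a ≡ fixed (axis d) b
  straight-fixed (step _ mv _ (stop _)) _ = move-fixed mv
  straight-fixed {d = d} {e ∷ ds} (step _ mv _ p) t with sameDir d e in same
  ... | false = ⊥-elim (1+n≢0 t)
  ... | true with sameDir⇒≡ d e same
  ...   | refl = trans (move-fixed mv) (straight-fixed p t)

  turning-point : ∀ {a b d ds} → Path G ok a b (d ∷ ds) → turns (d ∷ ds) ≤ 1 →
                  ∃ λ m → m ∈G G × fixed (axis d) a ≡ fixed (axis d) m × ∃ λ α → fixed α m ≡ fixed α b
  turning-point (step _ mv _ (stop mb)) _ = _ , mb , move-fixed mv , northSouth , refl
  turning-point {d = d} {e ∷ ds} (step _ mv _ p) t with sameDir d e in same
  ... | false = _ , path-start p , move-fixed mv , axis e , straight-fixed p (n≤0⇒n≡0 (≤-pred t))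
  ... | true with sameDir⇒≡ d e same
  ...   | refl = let m , mm , am , rest = turning-point p t in m , mm , trans (move-fixed mv) am , rest

  corner-via : ∀ α β {ax ay mx my bx by} →
               fixed α (ax , ay) ≡ fixed α (mx , my) → fixed β (mx , my) ≡ fixed β (bx , by) →
               (mx , my) ∈G G → (bx , by) ∈G G → HasCorner G (ax , ay) (bx , by)
  corner-via eastWest   northSouth refl refl mm _  = horizontal-first mm
  corner-via northSouth eastWest   refl refl mm _  = vertical-first mm
  corner-via eastWest   eastWest   refl refl _  mb = horizontal-first mb
  corner-via northSouth northSouth refl refl _  mb = vertical-first mb

  one-turn-corner : ∀ {a b ds} → Path G ok a b ds → turns ds ≤ 1 → HasCorner G a b
  one-turn-corner (stop m) _ = horizontal-first m
  one-turn-corner {ds = d ∷ _} p@(step _ _ _ _) t with turning-point p t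
  ... | m , mm , am , β , mb = corner-via (axis d) β am mb mm (path-end p)

Quadrant : Side → Side → Cell → Cell → Set
Quadrant sx sy (ex , ey) (x , y) = HalfLine sx ex x × HalfLine sy ey y

Quadrant? : ∀ sx sy e c → Dec (Quadrant sx sy e c)
Quadrant? sx sy (ex , ey) (x , y) = HalfLine? sx ex x ×-dec HalfLine? sy ey y

data QuadrantExit {w h} (G : Grid w h) (sx sy : Side) (ex ey : ℕ) : Set where
  across-column : ∀ {x y} → HalfLine sy ey y → (ex , y) ∈G G → ¬ HalfLine sx ex x → (x , y) ∈G G →
                  QuadrantExit G sx sy ex ey
  across-row    : ∀ {x y} → HalfLine sx ex x → (x , ey) ∈G G → ¬ HalfLine sy ey y → (x , y) ∈G G →
                  QuadrantExit G sx sy ex ey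

module _ {w h} {G : Grid w h} {ok : Dir → Set} {sx sy : Side} {ex ey : ℕ} where

  exit-move : ∀ {u d u′} → u ∈G G → u′ ∈G G → Move u d u′ →
              Quadrant sx sy (ex , ey) u → ¬ Quadrant sx sy (ex , ey) u′ → QuadrantExit G sx sy ex ey
  exit-move mu mu′ mvN (x-in , y-in) out with leave-upward y-in (λ y-in′ → out (x-in , y-in′))
  ... | refl = across-row x-in mu (λ y-in′ → out (x-in , y-in′)) mu′
  exit-move mu mu′ mvS (x-in , y-in) out with leave-downward y-in (λ y-in′ → out (x-in , y-in′))
  ... | refl = across-row x-in mu (λ y-in′ → out (x-in , y-in′)) mu′
  exit-move mu mu′ mvE (x-in , y-in) out with leave-upward x-in (λ x-in′ → out (x-in′ , y-in))
  ... | refl = across-column y-in mu (λ x-in′ → out (x-in′ , y-in)) mu′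
  exit-move mu mu′ mvW (x-in , y-in) out with leave-downward x-in (λ x-in′ → out (x-in′ , y-in))
  ... | refl = across-column y-in mu (λ x-in′ → out (x-in′ , y-in)) mu′

  leave-quadrant : ∀ {u v ds} → Path G ok u v ds →
                   Quadrant sx sy (ex , ey) u → ¬ Quadrant sx sy (ex , ey) v → QuadrantExit G sx sy ex ey
  leave-quadrant (stop _) q out = ⊥-elim (out q)
  leave-quadrant (step {b = u′} mu mv _ p) q out with Quadrant? sx sy (ex , ey) u′
  ... | yes q′ = leave-quadrant p q′ out
  ... | no out′ = exit-move mu (path-start p) mv q out′

module Convex {w h} {G : Grid w h} (cv : IsConvexPolyomino G) where

  connected : Connected G
  connected = proj₁ (proj₂ cv)

  column : ∀ x → IsInterval (Column G x)
  column x = proj₁ (proj₂ (proj₂ cv)) x _ _ _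

  row : ∀ y → IsInterval (Row G y)
  row y = proj₁ (proj₂ (proj₂ (proj₂ cv))) y _ _ _

  empty-quadrant : ∀ {sx sy ex ey x₀ y₀} → ¬ (ex , ey) ∈G G →
                   (x₀ , ey) ∈G G → ¬ HalfLine sx ex x₀ → (ex , y₀) ∈G G → ¬ HalfLine sy ey y₀ →
                   ∀ {c} → c ∈G G → ¬ Quadrant sx sy (ex , ey) c
  empty-quadrant {ex = ex} {ey} ¬e mr x₀-out mc y₀-out mcell q with connected _ _ mcell mr
  ... | _ , p with leave-quadrant p q (x₀-out ∘ proj₁)
  ... | across-column y-in m _ _ = ¬e (interval-crossing (column ex) m mc y-in y₀-out)
  ... | across-row    x-in m _ _ = ¬e (interval-crossing (row ey) m mr x-in x₀-out)

  south-or-west : ∀ {ax ay bx by} → (ax , ay) ∈G G → (suc bx , suc by) ∈G G → ax ≤ bx → ay ≤ by →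
                  (suc bx , by) ∈G G ⊎ (bx , suc by) ∈G G
  south-or-west {bx = bx} {by} ma mb x≤ y≤ with connected _ _ ma mb
  ... | _ , p with leave-quadrant {sx = below} {below} p (x≤ , y≤) (λ (sx≤x , _) → 1+n≰n sx≤x)
  ... | across-column {y = y} y≤by m x-out m′ =
          inj₁ (column (suc bx) (row y m m′ (n≤1+n bx) (≰⇒> x-out)) mb y≤by (n≤1+n by))
  ... | across-row {x} x≤bx m y-out m′ =
          inj₂ (row (suc by) (column x m m′ (n≤1+n by) (≰⇒> y-out)) mb x≤bx (n≤1+n bx))

  -- Built from its end: south-or-west supplies the cell before the last one.
  ne-path : ∀ {a b} → a ∈G G → b ∈G G → a ≤ne b → ∃ λ ds → Path G NEDir a b ds
  ne-path ma mb (x≤ , y≤) = go ma mb (≤⇒≤′ x≤) (≤⇒≤′ y≤)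
    where
      go : ∀ {ax ay bx by} → (ax , ay) ∈G G → (bx , by) ∈G G → ax ≤′ bx → ay ≤′ by →
           ∃ λ ds → Path G NEDir (ax , ay) (bx , by) ds
      go {ax} ma mb ≤′-refl y≤ = _ , proj₂ (north-segment (column ax) tt ma mb (≤′⇒≤ y≤))
      go {ay = ay} ma mb (≤′-step x≤) ≤′-refl = _ , proj₂ (east-segment (row ay) tt ma mb (≤′⇒≤ (≤′-step x≤)))
      go ma mb (≤′-step x≤) (≤′-step y≤) with south-or-west ma mb (≤′⇒≤ x≤) (≤′⇒≤ y≤)
      ... | inj₁ m = let _ , p = go ma m (≤′-step x≤) y≤ in _ , p ++ᴾ step m mvN tt (stop mb)
      ... | inj₂ m = let _ , p = go ma m x≤ (≤′-step y≤) in _ , p ++ᴾ step m mvE tt (stop mb)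

-- Reflection in a vertical axis

-- x′ = w ∸ 1 ∸ x for x < w, stated without truncated subtraction.
record Mirrored (w x x′ : ℕ) : Set where
  constructor mirrored
  field mirrored-sum : suc (x + x′) ≡ w
open Mirrored

module _ {w : ℕ} where

  mirrored-sym : ∀ {x x′} → Mirrored w x x′ → Mirrored w x′ x
  mirrored-sym {x} {x′} (mirrored e) = mirrored (trans (cong suc (+-comm x′ x)) e)

  mirrored-exists : ∀ {x} → x < w → ∃ (Mirrored w x)
  mirrored-exists x<w = let x′ , e = m≤n⇒∃[o]m+o≡n x<w in x′ , mirrored e

  mirrored-unique : ∀ {x x′ x″} → Mirrored w x′ x → Mirrored w x″ x → x′ ≡ x″
  mirrored-unique {x} e e′ =
    +-cancelˡ-≡ x _ _ (suc-injective (trans (mirrored-sum (mirrored-sym e)) (sym (mirrored-sum (mirrored-sym e′)))))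

  mirrored-antitone : ∀ {a a′ b b′} → Mirrored w a a′ → Mirrored w b b′ → a ≤ b → b′ ≤ a′
  mirrored-antitone {a} {a′} {b} {b′} (mirrored ea) (mirrored eb) a≤b =
    +-cancelˡ-≤ a _ _ (≤-trans (+-monoˡ-≤ b′ a≤b) (≤-reflexive (suc-injective (trans eb (sym ea)))))

  mirrored-shiftʳ : ∀ {x x′} → Mirrored w (suc x) x′ → Mirrored w x (suc x′)
  mirrored-shiftʳ {x} {x′} (mirrored e) = mirrored (trans (cong suc (+-suc x x′)) e)

  mirrored-shiftˡ : ∀ {x x′} → Mirrored w x (suc x′) → Mirrored w (suc x) x′
  mirrored-shiftˡ {x} {x′} (mirrored e) = mirrored (trans (cong suc (sym (+-suc x x′))) e)

  mirrored-< : ∀ {x x′} → Mirrored w x x′ → x < w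
  mirrored-< {x} {x′} (mirrored e) = ≤-trans (s≤s (m≤m+n x x′)) (≤-reflexive e)

vget-∷ʳ-last : ∀ {A : Set} {n} (u : Vec A n) a → vget (u ∷ʳ a) n ≡ just a
vget-∷ʳ-last []      a = refl
vget-∷ʳ-last (_ ∷ u) a = vget-∷ʳ-last u a

vget-∷ʳ-< : ∀ {A : Set} {n} (u : Vec A n) a {i} → i < n → vget (u ∷ʳ a) i ≡ vget u i
vget-∷ʳ-< (_ ∷ u) a {zero}  _         = refl
vget-∷ʳ-< (_ ∷ u) a {suc i} (s≤s i<n) = vget-∷ʳ-< u a i<n

vget-reverse : ∀ {A : Set} {n} (v : Vec A n) {x x′} → Mirrored n x x′ → vget (reverse v) x ≡ vget v x′
vget-reverse (a ∷ u) {x} {zero} (mirrored e)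
  rewrite reverse-∷ a u | suc-injective (trans (cong suc (sym (+-identityʳ x))) e) =
  vget-∷ʳ-last (reverse u) a
vget-reverse (a ∷ u) {x} {suc x′} (mirrored e) rewrite reverse-∷ a u =
  trans (vget-∷ʳ-< (reverse u) a (mirrored-< e′)) (vget-reverse u e′)
  where e′ = mirrored (trans (sym (+-suc x x′)) (suc-injective e))

mirror-dir : Dir → Dir
mirror-dir N = N
mirror-dir S = S
mirror-dir E = W
mirror-dir W = E

sameDir-mirror : ∀ d e → sameDir (mirror-dir d) (mirror-dir e) ≡ sameDir d e
sameDir-mirror N N = refl
sameDir-mirror N S = refl
sameDir-mirror N E = refl
sameDir-mirror N W = refl
sameDir-mirror S N = refl
sameDir-mirror S S = refl
sameDir-mirror S E = refl
sameDir-mirror S W = refl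
sameDir-mirror E N = refl
sameDir-mirror E S = refl
sameDir-mirror E E = refl
sameDir-mirror E W = refl
sameDir-mirror W N = refl
sameDir-mirror W S = refl
sameDir-mirror W E = refl
sameDir-mirror W W = refl

turns-mirror : ∀ ds → turns (map mirror-dir ds) ≡ turns ds
turns-mirror []           = refl
turns-mirror (d ∷ [])     = refl
turns-mirror (d ∷ e ∷ ds) =
  cong₂ _+_ (cong (λ b → if b then 0 else 1) (sameDir-mirror d e)) (turns-mirror (e ∷ ds))

record Mirror {w h} (G H : Grid w h) : Set where
  constructor mirror
  field mirror-mem : ∀ {x x′} → Mirrored w x x′ → ∀ y → mem H x y ≡ mem G x′ y
open Mirror

mirror-sym : ∀ {w h} {G H : Grid w h} → Mirror G H → Mirror H G
mirror-sym M = mirror λ e y → sym (mirror-mem M (mirrored-sym e) y)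

reverse-mirror : ∀ {w h} (G : Grid w h) → Mirror G (reverse G)
reverse-mirror G = mirror λ e y → cong (λ c → memCol c y) (vget-reverse G e)

module Mirroring {w h} {G H : Grid w h} (M : Mirror G H) where

  mirror-∈ : ∀ {x x′ y} → Mirrored w x x′ → (x′ , y) ∈G G → (x , y) ∈G H
  mirror-∈ e m = trans (mirror-mem M e _) m

  mirror-cell : ∀ {x′ y} → (x′ , y) ∈G G → ∃ λ x → Mirrored w x x′ × (x , y) ∈G H
  mirror-cell m with mirrored-exists (proj₁ (∈G-bounded G m))
  ... | x , e = x , mirrored-sym e , mirror-∈ (mirrored-sym e) m

  module _ {ok ok′ : Dir → Set} (f : ∀ {d} → ok d → ok′ (mirror-dir d)) where

    mirror-path-from : ∀ {x x′ y b ds} → Mirrored w x x′ → Path G ok (x′ , y) b ds →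
                       ∃ λ bx → Mirrored w bx (proj₁ b) × Path H ok′ (x , y) (bx , proj₂ b) (map mirror-dir ds)
    mirror-path-from e (stop m) = _ , e , stop (mirror-∈ e m)
    mirror-path-from e (step m mvN o p) =
      let bx , eb , q = mirror-path-from e p in bx , eb , step (mirror-∈ e m) mvN (f o) q
    mirror-path-from e (step m mvS o p) =
      let bx , eb , q = mirror-path-from e p in bx , eb , step (mirror-∈ e m) mvS (f o) q
    mirror-path-from {zero} (mirrored e) (step m mvE o p) =
      ⊥-elim (<-irrefl e (proj₁ (∈G-bounded G (path-start p))))
    mirror-path-from {suc x} e (step m mvE o p) =
      let bx , eb , q = mirror-path-from (mirrored-shiftʳ e) p in bx , eb , step (mirror-∈ e m) mvW (f o) q
    mirror-path-from e (step m mvW o p) =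
      let bx , eb , q = mirror-path-from (mirrored-shiftˡ e) p in bx , eb , step (mirror-∈ e m) mvE (f o) q

    mirror-path : ∀ {ax ax′ ay bx bx′ by ds} → Mirrored w ax ax′ → Mirrored w bx bx′ →
                  Path G ok (ax′ , ay) (bx′ , by) ds → Path H ok′ (ax , ay) (bx , by) (map mirror-dir ds)
    mirror-path {ay = ay} {by = by} ea eb p with mirror-path-from ea p
    ... | _ , eb′ , q = subst (λ z → Path H ok′ (_ , ay) (z , by) _) (mirrored-unique eb′ eb) q

ne→nw : ∀ {d} → NEDir d → NWDir (mirror-dir d)
ne→nw {N} _ = tt
ne→nw {E} _ = tt

nw→ne : ∀ {d} → NWDir d → NEDir (mirror-dir d)
nw→ne {N} _ = tt
nw→ne {W} _ = tt

module _ {w h} {G H : Grid w h} (M : Mirror G H) where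
  open Mirroring M
  private module M⁻¹ = Mirroring (mirror-sym M)

  mirror-nonempty : Nonempty G → Nonempty H
  mirror-nonempty ((_ , y) , m) = let x , _ , m′ = mirror-cell m in (x , y) , m′

  mirror-connected : Connected G → Connected H
  mirror-connected conn _ _ ma mb =
    let _ , ea , ma′ = M⁻¹.mirror-cell ma
        _ , eb , mb′ = M⁻¹.mirror-cell mb
        _ , p = conn _ _ ma′ mb′
    in _ , mirror-path (λ _ → tt) (mirrored-sym ea) (mirrored-sym eb) p

  mirror-columnConvex : ColumnConvex G → ColumnConvex H
  mirror-columnConvex cc x y₁ y₂ y m₁ m₂ l₁ l₂ =
    let x′ , e , m₁′ = M⁻¹.mirror-cell m₁
    in mirror-∈ (mirrored-sym e) (cc x′ y₁ y₂ y m₁′ (M⁻¹.mirror-∈ e m₂) l₁ l₂)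

  mirror-rowConvex : RowConvex G → RowConvex H
  mirror-rowConvex rc y x₁ x₂ x m₁ m₂ l₁ l₂ =
    let x₁′ , e₁ , m₁′ = M⁻¹.mirror-cell m₁
        x₂′ , e₂ , m₂′ = M⁻¹.mirror-cell m₂
        x′ , e = mirrored-exists (≤-<-trans l₂ (proj₁ (∈G-bounded H m₂)))
    in mirror-∈ e (rc y x₂′ x₁′ x′ m₂′ m₁′ (mirrored-antitone e (mirrored-sym e₂) l₂)
                                           (mirrored-antitone (mirrored-sym e₁) e l₁))

  mirror-columnsOccupied : ColumnsOccupied G → ColumnsOccupied H
  mirror-columnsOccupied co x x<w =
    let x′ , e = mirrored-exists x<w
        y , m = co x′ (mirrored-< (mirrored-sym e))
    in y , mirror-∈ e m

  mirror-rowsOccupied : RowsOccupied G → RowsOccupied H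
  mirror-rowsOccupied ro y y<h = let x , _ , m = mirror-cell (proj₂ (ro y y<h)) in x , m

  mirror-convex : IsConvexPolyomino G → IsConvexPolyomino H
  mirror-convex (ne , conn , cc , rc , co , ro) =
    mirror-nonempty ne , mirror-connected conn , mirror-columnConvex cc , mirror-rowConvex rc ,
    mirror-columnsOccupied co , mirror-rowsOccupied ro

  mirror-degree : ∀ {ok ok′ : Dir → Set} →
                  (∀ {d} → ok d → ok′ (mirror-dir d)) → (∀ {d} → ok′ d → ok (mirror-dir d)) →
                  ∀ {t} → DegLE ok G t → DegLE ok′ H t
  mirror-degree f g D _ _ (_ , p) =
    let _ , ea , _ = M⁻¹.mirror-cell (path-start p)
        _ , eb , _ = M⁻¹.mirror-cell (path-end p)
        es , q , t = D _ _ (_ , M⁻¹.mirror-path g ea eb p)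
    in map mirror-dir es , mirror-path f (mirrored-sym ea) (mirrored-sym eb) q , subst (_≤ _) (sym (turns-mirror es)) t

nw-path : ∀ {w h} {G : Grid w h} → IsConvexPolyomino G → ∀ {a b} → a ∈G G → b ∈G G → a ≤nw b →
          ∃ λ ds → Path G NWDir a b ds
nw-path {G = G} cv ma mb (x≥ , y≤) =
  let M = reverse-mirror G
      _ , ea , ma′ = Mirroring.mirror-cell M ma
      _ , eb , mb′ = Mirroring.mirror-cell M mb
      _ , p = Convex.ne-path (mirror-convex M cv) ma′ mb′ (mirrored-antitone (mirrored-sym eb) (mirrored-sym ea) x≥ , y≤)
  in _ , Mirroring.mirror-path (mirror-sym M) ne→nw (mirrored-sym ea) (mirrored-sym eb) p

-- Corner conditions

module _ {w h} (G : Grid w h) where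

  NECorners NWCorners AllCorners LPaths : Set
  NECorners = ∀ a → a ∈G G → ∀ b → b ∈G G → a ≤ne b → HasCorner G a b
  NWCorners = ∀ a → a ∈G G → ∀ b → b ∈G G → a ≤nw b → HasCorner G a b
  AllCorners = ∀ a b → a ∈G G → b ∈G G → HasCorner G a b
  LPaths = ∀ a b → a ∈G G → b ∈G G →
    ∃ λ v → ∃ λ hz → (v ≡ N ⊎ v ≡ S) × (hz ≡ E ⊎ hz ≡ W) ×
      ∃ λ ds → Path G (λ d → d ≡ v ⊎ d ≡ hz) a b ds × turns ds ≤ 1

vertical-dir : ∀ {y₁ y₂ v} → Vertical y₁ y₂ v → v ≡ N ⊎ v ≡ S
vertical-dir (north _) = inj₁ refl
vertical-dir (south _) = inj₂ refl

horizontal-dir : ∀ {x₁ x₂ hz} → Horizontal x₁ x₂ hz → hz ≡ E ⊎ hz ≡ W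
horizontal-dir (east _) = inj₁ refl
horizontal-dir (west _) = inj₂ refl

lpaths⇒allCorners : ∀ {w h} {G : Grid w h} → LPaths G → AllCorners G
lpaths⇒allCorners L a b ma mb = let _ , _ , _ , _ , _ , p , t = L a b ma mb in one-turn-corner p t

ne×nw⇒allCorners : ∀ {w h} {G : Grid w h} → NECorners G → NWCorners G → AllCorners G
ne×nw⇒allCorners C C′ (ax , ay) (bx , by) ma mb with ≤-total ax bx | ≤-total ay by
... | inj₁ x≤ | inj₁ y≤ = C _ ma _ mb (x≤ , y≤)
... | inj₂ x≥ | inj₁ y≤ = C′ _ ma _ mb (x≥ , y≤)
... | inj₂ x≥ | inj₂ y≥ = HasCorner-sym (C _ mb _ ma (x≥ , y≥))
... | inj₁ x≤ | inj₂ y≥ = HasCorner-sym (C′ _ mb _ ma (x≤ , y≥))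

module Corners {w h} {G : Grid w h} (cv : IsConvexPolyomino G) where
  open Convex cv

  corner-path : ∀ {ok : Dir → Set} {ax ay bx by v hz} → Vertical ay by v → Horizontal ax bx hz → ok v → ok hz →
                (ax , ay) ∈G G → (bx , by) ∈G G → HasCorner G (ax , ay) (bx , by) → Path≤ G ok 1 (ax , ay) (bx , by)
  corner-path {ay = ay} {bx} V H ov oh ma mb (horizontal-first mc) =
    two-segments (row-segment (row ay) H oh ma mc) (column-segment (column bx) V ov mc mb)
  corner-path {ax = ax} {by = by} V H ov oh ma mb (vertical-first mc) =
    two-segments (column-segment (column ax) V ov ma mc) (row-segment (row by) H oh mc mb)

  ne≤1⇒corners : DegLE NEDir G 1 → NECorners G
  ne≤1⇒corners D a ma b mb a≤b = let _ , p , t = D a b (ne-path ma mb a≤b) in one-turn-corner p t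

  ne-corner-path : ∀ {a b} → a ∈G G → b ∈G G → a ≤ne b → HasCorner G a b → Path≤ G NEDir 1 a b
  ne-corner-path ma mb (x≤ , y≤) = corner-path (north y≤) (east x≤) tt tt ma mb

  corners⇒ne≤1 : NECorners G → DegLE NEDir G 1
  corners⇒ne≤1 C a b (_ , p) =
    ne-corner-path (path-start p) (path-end p) (ne-monotone p) (C a (path-start p) b (path-end p) (ne-monotone p))

  nw≤1⇒corners : DegLE NWDir G 1 → NWCorners G
  nw≤1⇒corners D a ma b mb a≤b = let _ , p , t = D a b (nw-path cv ma mb a≤b) in one-turn-corner p t

  nw-corner-path : ∀ {a b} → a ∈G G → b ∈G G → a ≤nw b → HasCorner G a b → Path≤ G NWDir 1 a b
  nw-corner-path ma mb (x≥ , y≤) = corner-path (north y≤) (west x≥) tt tt ma mb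

  corners⇒nw≤1 : NWCorners G → DegLE NWDir G 1
  corners⇒nw≤1 C a b (_ , p) =
    nw-corner-path (path-start p) (path-end p) (nw-monotone p) (C a (path-start p) b (path-end p) (nw-monotone p))

  allCorners⇒lpaths : AllCorners G → LPaths G
  allCorners⇒lpaths C (ax , ay) (bx , by) ma mb =
    let v , V = vertical ay by
        hz , H = horizontal ax bx
    in v , hz , vertical-dir V , horizontal-dir H , corner-path V H (inj₁ refl) (inj₂ refl) ma mb (C _ _ ma mb)

-- Two turns suffice

module _ {w h} {G : Grid w h} where

  cross-column : ∀ x {cx cy q ds} → Path G NWDir (cx , cy) q ds → proj₁ q ≤ x → x ≤ cx →
                 ∃ λ y → cy ≤ y × (x , y) ∈G G × ∃ λ es → Path G NWDir (x , y) q es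
  cross-column x {cx} p q≤x x≤c with x ≟ cx
  ... | yes refl = _ , ≤-refl , path-start p , _ , p
  cross-column x (stop _) q≤x x≤c | no x≢c = ⊥-elim (x≢c (≤-antisym x≤c q≤x))
  cross-column x (step _ mvN _ p) q≤x x≤c | no _ =
    let y , c≤y , rest = cross-column x p q≤x x≤c in y , <⇒≤ c≤y , rest
  cross-column x (step _ mvW _ p) q≤x x≤c | no x≢c = cross-column x p q≤x (≤-pred (≤∧≢⇒< x≤c x≢c))

  cross-row : ∀ y {cx cy q ds} → Path G NWDir (cx , cy) q ds → cy ≤ y → y ≤ proj₂ q →
              ∃ λ x → x ≤ cx × (x , y) ∈G G × ∃ λ es → Path G NWDir (x , y) q es
  cross-row y {cy = cy} p c≤y y≤q with y ≟ cy
  ... | yes refl = _ , ≤-refl , path-start p , _ , p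
  cross-row y (stop _) c≤y y≤q | no y≢c = ⊥-elim (y≢c (≤-antisym y≤q c≤y))
  cross-row y (step _ mvW _ p) c≤y y≤q | no _ =
    let x , x≤c , rest = cross-row y p c≤y y≤q in x , m≤n⇒m≤1+n x≤c , rest
  cross-row y (step _ mvN _ p) c≤y y≤q | no y≢c = cross-row y p (≤∧≢⇒< c≤y (y≢c ∘ sym)) y≤q

module TwoTurns {w h} {G : Grid w h} (cv : IsConvexPolyomino G) where
  open Convex cv
  open Corners cv

  x-distinct : ∀ {x x′ y} → (x , y) ∈G G → ¬ (x′ , y) ∈G G → x ≤ x′ → ¬ x′ ≤ x
  x-distinct m ¬m′ x≤x′ x′≤x = ¬m′ (subst (λ z → (z , _) ∈G G) (≤-antisym x≤x′ x′≤x) m)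

  y-distinct : ∀ {x y y′} → (x , y) ∈G G → ¬ (x , y′) ∈G G → y ≤ y′ → ¬ y′ ≤ y
  y-distinct m ¬m′ y≤y′ y′≤y = ¬m′ (subst (λ z → (_ , z) ∈G G) (≤-antisym y≤y′ y′≤y) m)

  via-columns : ∀ {ax ay bx by s s′} → (ax , ay) ∈G G → (bx , by) ∈G G → (ax , ay) ≤ne (bx , by) →
                (ax , s) ∈G G → (bx , s′) ∈G G → s′ ≤ s → Path≤ G NEDir 2 (ax , ay) (bx , by)
  via-columns {ax} {bx = bx} ma mb (x≤ , y≤) m m′ s′≤s =
    let y , ay≤y , y≤by , my , my′ = common-point (column ax) (column bx) ma m m′ mb y≤ s′≤s
    in three-segments (north-segment (column ax) tt ma my ay≤y) (east-segment (row y) tt my my′ x≤)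
                      (north-segment (column bx) tt my′ mb y≤by)

  via-rows : ∀ {ax ay bx by r r′} → (ax , ay) ∈G G → (bx , by) ∈G G → (ax , ay) ≤ne (bx , by) →
             (r , ay) ∈G G → (r′ , by) ∈G G → r′ ≤ r → Path≤ G NEDir 2 (ax , ay) (bx , by)
  via-rows {ay = ay} {by = by} ma mb (x≤ , y≤) m m′ r′≤r =
    let x , ax≤x , x≤bx , mx , mx′ = common-point (row ay) (row by) ma m m′ mb x≤ r′≤r
    in three-segments (east-segment (row ay) tt ma mx ax≤x) (north-segment (column x) tt mx mx′ y≤)
                      (east-segment (row by) tt mx′ mb x≤bx)

  module _ {p q} (mp : p ∈G G) (mq : q ∈G G) (p≤q : p ≤nw q) where

    crossing-columns : ∀ {ax ay bx by} → proj₁ q ≤ ax → bx ≤ proj₁ p →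
                       (ax , ay) ∈G G → (bx , by) ∈G G → (ax , ay) ≤ne (bx , by) → Path≤ G NEDir 2 (ax , ay) (bx , by)
    crossing-columns {ax} {bx = bx} qx≤ax bx≤px ma mb a≤b@(x≤ , _) =
      let _ , _ , m′ , _ , σ′ = cross-column bx (proj₂ (nw-path cv mp mq p≤q)) (≤-trans qx≤ax x≤) bx≤px
          _ , s′≤s , m , _ = cross-column ax σ′ qx≤ax x≤
      in via-columns ma mb a≤b m m′ s′≤s

    crossing-rows : ∀ {ax ay bx by} → proj₂ p ≤ ay → by ≤ proj₂ q →
                    (ax , ay) ∈G G → (bx , by) ∈G G → (ax , ay) ≤ne (bx , by) → Path≤ G NEDir 2 (ax , ay) (bx , by)
    crossing-rows {ay = ay} {by = by} py≤ay by≤qy ma mb a≤b@(_ , y≤) =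
      let _ , _ , m , _ , σ′ = cross-row ay (proj₂ (nw-path cv mp mq p≤q)) py≤ay (≤-trans y≤ by≤qy)
          _ , r′≤r , m′ , _ = cross-row by σ′ y≤ by≤qy
      in via-rows ma mb a≤b m m′ r′≤r

  module _ {ax ay bx by} (ma : (ax , ay) ∈G G) (mb : (bx , by) ∈G G) (a≤b : (ax , ay) ≤ne (bx , by))
           (¬c : ¬ HasCorner G (ax , ay) (bx , by)) where
    private
      bx≰ax : ¬ bx ≤ ax
      bx≰ax = x-distinct ma (¬c ∘ horizontal-first) (proj₁ a≤b)
      by≰ay : ¬ by ≤ ay
      by≰ay = y-distinct ma (¬c ∘ vertical-first) (proj₂ a≤b)

    south-east-empty : ∀ {c} → c ∈G G → ¬ Quadrant above below (bx , ay) c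
    south-east-empty = empty-quadrant {above} {below} (¬c ∘ horizontal-first) ma bx≰ax mb by≰ay

    north-west-empty : ∀ {c} → c ∈G G → ¬ Quadrant below above (ax , by) c
    north-west-empty = empty-quadrant {below} {above} (¬c ∘ vertical-first) mb bx≰ax ma by≰ay

  module _ {px py qx qy} (mp : (px , py) ∈G G) (mq : (qx , qy) ∈G G) (p≤q : (px , py) ≤nw (qx , qy))
           (¬c : ¬ HasCorner G (px , py) (qx , qy)) where
    private
      px≰qx : ¬ px ≤ qx
      px≰qx = x-distinct mq (¬c ∘ vertical-first) (proj₁ p≤q)
      qy≰py : ¬ qy ≤ py
      qy≰py = y-distinct mp (¬c ∘ vertical-first) (proj₂ p≤q)

    south-west-empty : ∀ {c} → c ∈G G → ¬ Quadrant below below (qx , py) c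
    south-west-empty = empty-quadrant {below} {below} (¬c ∘ horizontal-first) mp px≰qx mq qy≰py

    north-east-empty : ∀ {c} → c ∈G G → ¬ Quadrant above above (px , qy) c
    north-east-empty = empty-quadrant {above} {above} (¬c ∘ vertical-first) mq px≰qx mp qy≰py

  module _ {px py qx qy ax ay bx by}
           (mp : (px , py) ∈G G) (mq : (qx , qy) ∈G G) (p≤q : (px , py) ≤nw (qx , qy))
           (¬pq : ¬ HasCorner G (px , py) (qx , qy))
           (ma : (ax , ay) ∈G G) (mb : (bx , by) ∈G G) (a≤b : (ax , ay) ≤ne (bx , by))
           (¬ab : ¬ HasCorner G (ax , ay) (bx , by))
           where

    q-west-of-a : qx ≤ ax → Path≤ G NEDir 2 (ax , ay) (bx , by)
    q-west-of-a qx≤ax with bx ≤? px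
    ... | yes bx≤px = crossing-columns mp mq p≤q qx≤ax bx≤px ma mb a≤b
    ... | no bx≰px with qy ≤? by
    ...   | yes qy≤by = ⊥-elim (north-east-empty mp mq p≤q ¬pq mb (<⇒≤ (≰⇒> bx≰px) , qy≤by))
    ...   | no qy≰by  = ⊥-elim (north-west-empty ma mb a≤b ¬ab mq (qx≤ax , <⇒≤ (≰⇒> qy≰by)))

    a-west-of-q : ax < qx → Path≤ G NEDir 2 (ax , ay) (bx , by)
    a-west-of-q ax<qx with ay ≤? py
    ... | yes ay≤py = ⊥-elim (south-west-empty mp mq p≤q ¬pq ma (<⇒≤ ax<qx , ay≤py))
    ... | no ay≰py with by ≤? qy
    ...   | yes by≤qy = crossing-rows mp mq p≤q (<⇒≤ (≰⇒> ay≰py)) by≤qy ma mb a≤b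
    ...   | no by≰qy with px ≤? bx
    ...     | yes px≤bx = ⊥-elim (north-east-empty mp mq p≤q ¬pq mb (px≤bx , <⇒≤ (≰⇒> by≰qy)))
    ...     | no px≰bx  = ⊥-elim (south-east-empty ma mb a≤b ¬ab mp (<⇒≤ (≰⇒> px≰bx) , <⇒≤ (≰⇒> ay≰py)))

    cornerless-pairs : Path≤ G NEDir 2 (ax , ay) (bx , by)
    cornerless-pairs with qx ≤? ax
    ... | yes qx≤ax = q-west-of-a qx≤ax
    ... | no qx≰ax  = a-west-of-q (≰⇒> qx≰ax)

  cornerless-nw⇒ne≤2 : ∀ {p q} → p ∈G G → q ∈G G → p ≤nw q → ¬ HasCorner G p q → DegLE NEDir G 2
  cornerless-nw⇒ne≤2 mp mq p≤q ¬pq a b (_ , π) with HasCorner? G a b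
  ... | yes c  = let ds , σ , t = ne-corner-path (path-start π) (path-end π) (ne-monotone π) c in ds , σ , m≤n⇒m≤1+n t
  ... | no ¬c = cornerless-pairs mp mq p≤q ¬pq (path-start π) (path-end π) (ne-monotone π) ¬c

-- Deciding convexity and the corner conditions

module _ {w h} {G : Grid w h} where

  module _ (cc : ColumnConvex G) (ov : Overlapping G) where

    eastward-path : ∀ {ax ay bx by} → (ax , ay) ∈G G → (bx , by) ∈G G → ax ≤′ bx →
                    ∃ λ ds → Path G AnyDir (ax , ay) (bx , by) ds
    eastward-path {ax} {ay} {by = by} ma mb ≤′-refl =
      _ , proj₂ (column-segment (cc ax _ _ _) (proj₂ (vertical ay by)) tt ma mb)
    eastward-path {bx = suc bx} {by} ma mb (≤′-step le) =
      let r , m , m′ = ov bx (proj₁ (∈G-bounded G mb))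
          _ , p = eastward-path ma m le
          _ , q = column-segment (cc (suc bx) _ _ _) (proj₂ (vertical r by)) tt m′ mb
      in _ , p ++ᴾ step m mvE tt q

    overlapping⇒connected : Connected G
    overlapping⇒connected (ax , _) (bx , _) ma mb with ≤-total ax bx
    ... | inj₁ le = eastward-path ma mb (≤⇒≤′ le)
    ... | inj₂ ge = path-reverse (proj₂ (eastward-path mb ma (≤⇒≤′ ge)))

  connected⇒overlapping : RowConvex G → ColumnsOccupied G → Connected G → Overlapping G
  connected⇒overlapping rc co conn x sx<w =
    let _ , m₀ = co x (<⇒≤ sx<w)
        _ , m₁ = co (suc x) sx<w
        _ , p = conn _ _ m₀ m₁
    in crossing (leave-quadrant {sx = below} {above} {x} {0} p (≤-refl , z≤n) (λ (sx≤x , _) → 1+n≰n sx≤x))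
    where
      crossing : QuadrantExit G below above x 0 → ∃ λ y → (x , y) ∈G G × (suc x , y) ∈G G
      crossing (across-column {x′} {y} _ m x′-out m′) = y , m , rc y x x′ (suc x) m m′ (n≤1+n x) (≰⇒> x′-out)
      crossing (across-row _ _ y-out _) = ⊥-elim (y-out z≤n)

module _ {w h} (G : Grid w h) where

  any-cell? : ∀ {P : Cell → Set} → (∀ c → Dec (P c)) → Dec (∃ λ c → c ∈G G × P c)
  any-cell? P? =
    map′ (λ (x , _ , y , _ , m , p) → (x , y) , m , p)
         (λ ((x , y) , m , p) → let x<w , y<h = ∈G-bounded G m in x , x<w , y , y<h , m , p)
         (anyUpTo? (λ x → anyUpTo? (λ y → ((x , y) ∈G? G) ×-dec P? (x , y)) h) w)

  module _ {P : Cell → Set} (P? : ∀ c → Dec (P c)) where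

    no-counterexample : ¬ (∃ λ c → c ∈G G × ¬ P c) → ∀ c → c ∈G G → P c
    no-counterexample none c m = decidable-stable (P? c) (λ ¬p → none (c , m , ¬p))

    all-cells? : Dec (∀ c → c ∈G G → P c)
    all-cells? = map′ no-counterexample (λ all (c , m , ¬p) → ¬p (all c m)) (¬? (any-cell? (¬? ∘ P?)))

    counterexample : ¬ (∀ c → c ∈G G → P c) → ∃ λ c → c ∈G G × ¬ P c
    counterexample ¬all with any-cell? (¬? ∘ P?)
    ... | yes found = found
    ... | no none   = ⊥-elim (¬all (no-counterexample none))

  nonempty? : Dec (Nonempty G)
  nonempty? = map′ (λ (c , m , _) → c , m) (λ (c , m) → c , m , tt) (any-cell? (λ _ → yes tt))

  columnConvex? : Dec (ColumnConvex G)
  columnConvex? =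
    map′ (λ all x y₁ y₂ y m₁ m₂ l₁ l₂ → all _ m₁ _ m₂ refl (≤-<-trans l₂ (proj₂ (∈G-bounded G m₂))) l₁ l₂)
         (λ cc (x , y₁) m₁ (x′ , y₂) m₂ x≡x′ {y} _ l₁ l₂ →
            cc x y₁ y₂ y m₁ (subst (λ z → (z , y₂) ∈G G) (sym x≡x′) m₂) l₁ l₂)
         (all-cells? λ (x , y₁) → all-cells? λ (x′ , y₂) →
            (x ≟ x′) →-dec allUpTo? (λ y → (y₁ ≤? y) →-dec (y ≤? y₂) →-dec ((x , y) ∈G? G)) h)

  rowConvex? : Dec (RowConvex G)
  rowConvex? =
    map′ (λ all y x₁ x₂ x m₁ m₂ l₁ l₂ → all _ m₁ _ m₂ refl (≤-<-trans l₂ (proj₁ (∈G-bounded G m₂))) l₁ l₂)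
         (λ rc (x₁ , y) m₁ (x₂ , y′) m₂ y≡y′ {x} _ l₁ l₂ →
            rc y x₁ x₂ x m₁ (subst (λ z → (x₂ , z) ∈G G) (sym y≡y′) m₂) l₁ l₂)
         (all-cells? λ (x₁ , y) → all-cells? λ (x₂ , y′) →
            (y ≟ y′) →-dec allUpTo? (λ x → (x₁ ≤? x) →-dec (x ≤? x₂) →-dec ((x , y) ∈G? G)) w)

  columnsOccupied? : Dec (ColumnsOccupied G)
  columnsOccupied? = map′ from to (allUpTo? (λ x → any-cell? (λ c → proj₁ c ≟ x)) w)
    where
      from : (∀ {x} → x < w → ∃ λ c → c ∈G G × proj₁ c ≡ x) → ColumnsOccupied G
      from all x x<w with all x<w
      ... | (_ , y) , m , refl = y , m
      to : ColumnsOccupied G → ∀ {x} → x < w → ∃ λ c → c ∈G G × proj₁ c ≡ x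
      to co {x} x<w = let y , m = co x x<w in (x , y) , m , refl

  rowsOccupied? : Dec (RowsOccupied G)
  rowsOccupied? = map′ from to (allUpTo? (λ y → any-cell? (λ c → proj₂ c ≟ y)) h)
    where
      from : (∀ {y} → y < h → ∃ λ c → c ∈G G × proj₂ c ≡ y) → RowsOccupied G
      from all y y<h with all y<h
      ... | (x , _) , m , refl = x , m
      to : RowsOccupied G → ∀ {y} → y < h → ∃ λ c → c ∈G G × proj₂ c ≡ y
      to ro {y} y<h = let x , m = ro y y<h in (x , y) , m , refl

  overlapping? : Dec (Overlapping G)
  overlapping? = map′ from to (allUpTo? (λ x → suc x <? w →-dec any-cell? (Overlap? x)) w)
    where
      Overlap : ℕ → Cell → Set
      Overlap x (x′ , y) = x′ ≡ x × (suc x , y) ∈G G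
      Overlap? : ∀ x c → Dec (Overlap x c)
      Overlap? x (x′ , y) = (x′ ≟ x) ×-dec ((suc x , y) ∈G? G)
      from : (∀ {x} → x < w → suc x < w → ∃ λ c → c ∈G G × Overlap x c) → Overlapping G
      from all x sx<w with all (≤-trans (n≤1+n _) sx<w) sx<w
      ... | (_ , y) , m , refl , m′ = y , m , m′
      to : Overlapping G → ∀ {x} → x < w → suc x < w → ∃ λ c → c ∈G G × Overlap x c
      to ov {x} _ sx<w = let y , m , m′ = ov x sx<w in (x , y) , m , refl , m′

  convex? : Dec (IsConvexPolyomino G)
  convex? =
    map′ (λ (ne , cc , rc , co , ro , ov) → ne , overlapping⇒connected cc ov , cc , rc , co , ro)
         (λ (ne , conn , cc , rc , co , ro) → ne , cc , rc , co , ro , connected⇒overlapping rc co conn)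
         (nonempty? ×-dec columnConvex? ×-dec rowConvex? ×-dec columnsOccupied? ×-dec rowsOccupied? ×-dec overlapping?)

module _ {w h} (G : Grid w h) where

  neCorners? : Dec (NECorners G)
  neCorners? = all-cells? G λ a → all-cells? G λ b → (a ≤ne? b) →-dec HasCorner? G a b

  nwCorners? : Dec (NWCorners G)
  nwCorners? = all-cells? G λ a → all-cells? G λ b → (a ≤nw? b) →-dec HasCorner? G a b

  cornerless-nw-pair : ¬ NWCorners G → ∃ λ p → ∃ λ q → p ∈G G × q ∈G G × p ≤nw q × ¬ HasCorner G p q
  cornerless-nw-pair ¬C with counterexample G (λ a → all-cells? G λ b → (a ≤nw? b) →-dec HasCorner? G a b) ¬C
  ... | p , mp , ¬Cp with counterexample G (λ b → (p ≤nw? b) →-dec HasCorner? G p b) ¬Cp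
  ...   | q , mq , ¬Cpq with p ≤nw? q
  ...     | yes p≤q = p , q , mp , mq , p≤q , (λ c → ¬Cpq (λ _ → c))
  ...     | no p≰q  = ⊥-elim (¬Cpq (⊥-elim ∘ p≰q))

¬nw≤1⇒ne≤2 : ∀ {w h} {G : Grid w h} → IsConvexPolyomino G → ¬ DegLE NWDir G 1 → DegLE NEDir G 2
¬nw≤1⇒ne≤2 {G = G} cv ¬D =
  let _ , _ , mp , mq , p≤q , ¬c = cornerless-nw-pair G (¬D ∘ Corners.corners⇒nw≤1 cv)
  in TwoTurns.cornerless-nw⇒ne≤2 cv mp mq p≤q ¬c

degrees>1⇒degrees≤2 : ∀ {w h} {G : Grid w h} → IsConvexPolyomino G → ¬ DegLE NEDir G 1 → ¬ DegLE NWDir G 1 →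
                      DegLE NEDir G 2 × DegLE NWDir G 2
degrees>1⇒degrees≤2 {G = G} cv ¬ne ¬nw =
  ¬nw≤1⇒ne≤2 cv ¬nw ,
  mirror-degree M⁻¹ ne→nw nw→ne (¬nw≤1⇒ne≤2 (mirror-convex M cv) (¬ne ∘ mirror-degree M⁻¹ nw→ne ne→nw))
  where
    M = reverse-mirror G
    M⁻¹ = mirror-sym M

IsDescending : ∀ {w h} → Grid w h → Set
IsDescending G = IsConvexPolyomino G × DegLE NEDir G 1

module _ {w h} {G : Grid w h} where

  ascending-by-corners : (IsConvexPolyomino G × NWCorners G) ⇔ IsAscending G
  ascending-by-corners = mk⇔ (λ (cv , C) → cv , Corners.corners⇒nw≤1 cv C)
                              (λ (cv , D) → cv , Corners.nw≤1⇒corners cv D)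

  descending-by-corners : (IsConvexPolyomino G × NECorners G) ⇔ IsDescending G
  descending-by-corners = mk⇔ (λ (cv , C) → cv , Corners.corners⇒ne≤1 cv C)
                               (λ (cv , D) → cv , Corners.ne≤1⇒corners cv D)

  lConvex-by-corners : (IsConvexPolyomino G × NECorners G × NWCorners G) ⇔ IsLConvex G
  lConvex-by-corners = mk⇔ (λ (cv , C , C′) → cv , Corners.allCorners⇒lpaths cv (ne×nw⇒allCorners C C′))
                            (λ (cv , L) → let C = lpaths⇒allCorners L in
                                           cv , (λ a ma b mb _ → C a b ma mb) , (λ a ma b mb _ → C a b ma mb))

  deg22-by-corners : (IsConvexPolyomino G × ¬ NECorners G × ¬ NWCorners G) ⇔ IsDeg22 G
  deg22-by-corners = mk⇔ to from
    where
      to : IsConvexPolyomino G × ¬ NECorners G × ¬ NWCorners G → IsDeg22 G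
      to (cv , ¬C , ¬C′) =
        let ¬ne = ¬C ∘ Corners.ne≤1⇒corners cv
            ¬nw = ¬C′ ∘ Corners.nw≤1⇒corners cv
            ne≤2 , nw≤2 = degrees>1⇒degrees≤2 cv ¬ne ¬nw
        in cv , (ne≤2 , ¬ne) , (nw≤2 , ¬nw)
      from : IsDeg22 G → IsConvexPolyomino G × ¬ NECorners G × ¬ NWCorners G
      from (cv , (_ , ¬ne) , (_ , ¬nw)) = cv , ¬ne ∘ Corners.corners⇒ne≤1 cv , ¬nw ∘ Corners.corners⇒nw≤1 cv

ascending⇔descending-reverse : ∀ {w h} {G : Grid w h} → IsAscending G ⇔ IsDescending (reverse G)
ascending⇔descending-reverse {G = G} =
  mk⇔ (λ (cv , D) → mirror-convex M cv , mirror-degree M nw→ne ne→nw D)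
      (λ (cv , D) → mirror-convex M⁻¹ cv , mirror-degree M⁻¹ ne→nw nw→ne D)
  where
    M = reverse-mirror G
    M⁻¹ = mirror-sym M

module _ {w h} (G : Grid w h) where

  ascending? : Dec (IsAscending G)
  ascending? = Dec.map ascending-by-corners (convex? G ×-dec nwCorners? G)

  descending? : Dec (IsDescending G)
  descending? = Dec.map descending-by-corners (convex? G ×-dec neCorners? G)

  lConvex? : Dec (IsLConvex G)
  lConvex? = Dec.map lConvex-by-corners (convex? G ×-dec (neCorners? G ×-dec nwCorners? G))

  deg22? : Dec (IsDeg22 G)
  deg22? = Dec.map deg22-by-corners (convex? G ×-dec (¬? (neCorners? G) ×-dec ¬? (nwCorners? G)))

-- Counting

indicator : Bool → ℕ
indicator b = if b then 1 else 0

∑ : ∀ {A : Set} → List A → (A → ℕ) → ℕ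
∑ xs f = sum (map f xs)

count : ∀ {A : Set} {P : A → Set} → (∀ x → Dec (P x)) → List A → ℕ
count P? xs = ∑ xs (indicator ∘ does ∘ P?)

count-Count : ∀ {A : Set} {P : A → Set} (P? : ∀ x → Dec (P x)) xs → Count P xs (count P? xs)
count-Count P? [] = nil
count-Count P? (x ∷ xs) with P? x
... | yes p = here p (count-Count P? xs)
... | no ¬p = skip ¬p (count-Count P? xs)

∑-cong : ∀ {A : Set} {f g : A → ℕ} → (∀ x → f x ≡ g x) → ∀ xs → ∑ xs f ≡ ∑ xs g
∑-cong f≗g xs = cong sum (map-cong f≗g xs)

∑-+ : ∀ {A : Set} (f g : A → ℕ) xs → ∑ xs (λ x → f x + g x) ≡ ∑ xs f + ∑ xs g
∑-+ f g []       = refl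
∑-+ f g (x ∷ xs) = trans (cong (f x + g x +_) (∑-+ f g xs)) (interchange (f x) (g x) _ _)

∑-zero : ∀ {A : Set} (xs : List A) → ∑ xs (λ _ → 0) ≡ 0
∑-zero []       = refl
∑-zero (_ ∷ xs) = ∑-zero xs

∑-++ : ∀ {A : Set} (f : A → ℕ) xs ys → ∑ (xs ++ ys) f ≡ ∑ xs f + ∑ ys f
∑-++ f xs ys = trans (cong sum (map-++ f xs ys)) (sum-++ (map f xs) (map f ys))

∑-map : ∀ {A B : Set} (f : B → ℕ) (g : A → B) xs → ∑ (map g xs) f ≡ ∑ xs (f ∘ g)
∑-map f g xs = cong sum (sym (map-∘ xs))

∑-concatMap : ∀ {A B : Set} (f : B → ℕ) (g : A → List B) xs → ∑ (concatMap g xs) f ≡ ∑ xs (λ x → ∑ (g x) f)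
∑-concatMap f g []       = refl
∑-concatMap f g (x ∷ xs) = trans (∑-++ f (g x) (concatMap g xs)) (cong (∑ (g x) f +_) (∑-concatMap f g xs))

∑-swap : ∀ {A B : Set} (f : A → B → ℕ) xs ys → ∑ xs (λ x → ∑ ys (f x)) ≡ ∑ ys (λ y → ∑ xs (λ x → f x y))
∑-swap f []       ys = sym (∑-zero ys)
∑-swap f (x ∷ xs) ys = trans (cong (∑ ys (f x) +_) (∑-swap f xs ys)) (sym (∑-+ (f x) _ ys))

module _ {A : Set} (xs : List A) where

  ∑-allVecs-∷ : ∀ k (f : Vec A (suc k) → ℕ) →
                ∑ (allVecs (suc k) xs) f ≡ ∑ xs (λ x → ∑ (allVecs k xs) (λ v → f (x ∷ v)))
  ∑-allVecs-∷ k f = trans (∑-concatMap f _ xs) (∑-cong (λ x → ∑-map f (x ∷_) (allVecs k xs)) xs)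

  ∑-allVecs-∷ʳ : ∀ k (f : Vec A (suc k) → ℕ) →
                 ∑ (allVecs (suc k) xs) f ≡ ∑ xs (λ x → ∑ (allVecs k xs) (λ v → f (v ∷ʳ x)))
  ∑-allVecs-∷ʳ zero    f = ∑-allVecs-∷ zero f
  ∑-allVecs-∷ʳ (suc k) f = begin
    ∑ (allVecs (2 + k) xs) f
      ≡⟨ ∑-allVecs-∷ (suc k) f ⟩
    ∑ xs (λ y → ∑ (allVecs (suc k) xs) (λ u → f (y ∷ u)))
      ≡⟨ ∑-cong (λ y → ∑-allVecs-∷ʳ k (λ u → f (y ∷ u))) xs ⟩
    ∑ xs (λ y → ∑ xs (λ x → ∑ (allVecs k xs) (λ v → f (y ∷ (v ∷ʳ x)))))
      ≡⟨ ∑-swap (λ y x → ∑ (allVecs k xs) (λ v → f (y ∷ (v ∷ʳ x)))) xs xs ⟩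
    ∑ xs (λ x → ∑ xs (λ y → ∑ (allVecs k xs) (λ v → f (y ∷ (v ∷ʳ x)))))
      ≡⟨ ∑-cong (λ x → ∑-allVecs-∷ k (λ u → f (u ∷ʳ x))) xs ⟨
    ∑ xs (λ x → ∑ (allVecs (suc k) xs) (λ u → f (u ∷ʳ x)))
      ∎

  ∑-allVecs-reverse : ∀ k (f : Vec A k → ℕ) → ∑ (allVecs k xs) (f ∘ reverse) ≡ ∑ (allVecs k xs) f
  ∑-allVecs-reverse zero    f = refl
  ∑-allVecs-reverse (suc k) f = begin
    ∑ (allVecs (suc k) xs) (f ∘ reverse)
      ≡⟨ ∑-allVecs-∷ k (f ∘ reverse) ⟩
    ∑ xs (λ x → ∑ (allVecs k xs) (λ v → f (reverse (x ∷ v))))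
      ≡⟨ ∑-cong (λ x → ∑-cong (λ v → cong f (reverse-∷ x v)) (allVecs k xs)) xs ⟩
    ∑ xs (λ x → ∑ (allVecs k xs) (λ v → f (reverse v ∷ʳ x)))
      ≡⟨ ∑-cong (λ x → ∑-allVecs-reverse k (λ v → f (v ∷ʳ x))) xs ⟩
    ∑ xs (λ x → ∑ (allVecs k xs) (λ v → f (v ∷ʳ x)))
      ≡⟨ ∑-allVecs-∷ʳ k f ⟨
    ∑ (allVecs (suc k) xs) f
      ∎

onShape? : ∀ {n} {Q : ∀ {w h} → Grid w h → Set} → (∀ {w h} (G : Grid w h) → Dec (Q G)) →
           ∀ s → Dec (onShape {n} Q s)
onShape? Q? (_ , G) = Q? G

∑-shapes : ∀ n (f : Shape n → ℕ) →
           ∑ (shapes n) f ≡ ∑ (upTo (suc n)) (λ w → ∑ (allGrids w (n ∸ w)) (λ G → f (w , G)))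
∑-shapes n f = trans (∑-concatMap f (λ w → map (w ,_) (allGrids w (n ∸ w))) (upTo (suc n)))
                     (∑-cong (λ w → ∑-map f (w ,_) (allGrids w (n ∸ w))) (upTo (suc n)))

∑-shapes-reverse : ∀ n (f : ∀ {w h} → Grid w h → ℕ) →
                   ∑ (shapes n) (λ s → f (reverse (proj₂ s))) ≡ ∑ (shapes n) (λ s → f (proj₂ s))
∑-shapes-reverse n f = begin
  ∑ (shapes n) (λ s → f (reverse (proj₂ s)))                       ≡⟨ ∑-shapes n _ ⟩
  ∑ ws (λ w → ∑ (allGrids w (n ∸ w)) (λ G → f (reverse G)))       ≡⟨ ∑-cong reverse-invariant ws ⟩
  ∑ ws (λ w → ∑ (allGrids w (n ∸ w)) f)                             ≡⟨ ∑-shapes n _ ⟨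
  ∑ (shapes n) (λ s → f (proj₂ s))                                   ∎
  where
    ws = upTo (suc n)
    reverse-invariant : ∀ w → ∑ (allGrids w (n ∸ w)) (λ G → f (reverse G)) ≡ ∑ (allGrids w (n ∸ w)) f
    reverse-invariant w = ∑-allVecs-reverse (allVecs (n ∸ w) (true ∷ false ∷ [])) w f

-- With c, e, n the decisions of convexity, NECorners and NWCorners: a convex polyomino
-- satisfying both corner conditions is counted by c, l, a and d, one satisfying exactly one
-- by c and a or d, and one satisfying neither by c and k.
convexity-identity : ∀ c e n → indicator c + indicator (c ∧ (e ∧ n)) ≡
                                indicator (c ∧ n) + indicator (c ∧ e) + indicator (c ∧ (not e ∧ not n))
convexity-identity false _     _     = refl
convexity-identity true  true  true  = refl
convexity-identity true  true  false = refl
convexity-identity true  false true  = refl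
convexity-identity true  false false = refl

module Counts (n : ℕ) where

  c a d k l : ℕ
  c = count (onShape? convex?) (shapes n)
  a = count (onShape? ascending?) (shapes n)
  d = count (onShape? descending?) (shapes n)
  k = count (onShape? deg22?) (shapes n)
  l = count (onShape? lConvex?) (shapes n)

  convex+lConvex : c + l ≡ a + d + k
  convex+lConvex = begin
    ∑ sh iC + ∑ sh iL                  ≡⟨ ∑-+ iC iL sh ⟨
    ∑ sh (λ s → iC s + iL s)           ≡⟨ ∑-cong pointwise sh ⟩
    ∑ sh (λ s → iA s + iD s + iK s)    ≡⟨ ∑-+ (λ s → iA s + iD s) iK sh ⟩
    ∑ sh (λ s → iA s + iD s) + k       ≡⟨ cong (_+ k) (∑-+ iA iD sh) ⟩
    a + d + k                          ∎
    where
      sh = shapes n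
      iC iA iD iK iL : Shape n → ℕ
      iC = indicator ∘ does ∘ onShape? convex?
      iA = indicator ∘ does ∘ onShape? ascending?
      iD = indicator ∘ does ∘ onShape? descending?
      iK = indicator ∘ does ∘ onShape? deg22?
      iL = indicator ∘ does ∘ onShape? lConvex?
      pointwise : ∀ s → iC s + iL s ≡ iA s + iD s + iK s
      pointwise (_ , G) = convexity-identity (does (convex? G)) (does (neCorners? G)) (does (nwCorners? G))

  descending≡ascending : d ≡ a
  descending≡ascending = begin
    d                                                    ≡⟨ ∑-shapes-reverse n (λ G → [ descending? G ]) ⟨
    ∑ (shapes n) (λ s → [ descending? (reverse (proj₂ s)) ]) ≡⟨ ∑-cong (λ s → reflect (proj₂ s)) (shapes n) ⟨
    a                                                    ∎
    where
      [_] : ∀ {P : Set} → Dec P → ℕ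
      [ P? ] = indicator (does P?)
      reflect : ∀ {w h} (G : Grid w h) → [ ascending? G ] ≡ [ descending? (reverse G) ]
      reflect G = cong indicator (does-⇔ ascending⇔descending-reverse (ascending? G) (descending? (reverse G)))

proposition3 : ∀ (n : ℕ) → 2 ≤ n →
  ∃ λ c → ∃ λ a → ∃ λ k → ∃ λ l →
    Count (onShape IsConvexPolyomino) (shapes n) c
    × Count (onShape IsAscending) (shapes n) a
    × Count (onShape IsDeg22) (shapes n) k
    × Count (onShape IsLConvex) (shapes n) l
    × c + l ≡ 2 * a + k
proposition3 n _ =
  c , a , k , l ,
  count-Count (onShape? convex?) (shapes n) , count-Count (onShape? ascending?) (shapes n) ,
  count-Count (onShape? deg22?) (shapes n) , count-Count (onShape? lConvex?) (shapes n) ,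
  (begin
    c + l          ≡⟨ convex+lConvex ⟩
    a + d + k      ≡⟨ cong (λ z → a + z + k) descending≡ascending ⟩
    a + a + k      ≡⟨ cong (λ z → a + z + k) (+-identityʳ a) ⟨
    2 * a + k      ∎)
  where open Counts n
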